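{- Let $a>0$ and $r>0$, and let $G$ be a graph of order $n$ with average degree $d\le r$. Let $X,Y,Z$ be a partition of $V(G)$ into three disjoint sets with $X\neq\emptyset$, $|Y|\le \frac{|X|}{2a}$ and $e(X,Z)\le\frac{r}{4a}|X|$. Then either the graph $G\setminus X$ (obtained by deleting $X$) has average degree at least $d$, or the subgraph of $G$ induced by $X\cup Y$ has average degree at least $d-\frac{r}{a}$.
   Context: All graphs are finite, simple. $e(X,Z)$ denotes the number of edges between disjoint sets $X$ and $Z$. The average degree of a graph $F$ is $2|E(F)|/|V(F)|$.
   Formalization: The parameters a and r range over the positive rationals. -}

module Defs where

open import Data.Bool using (Bool; true; false; _∧_; if_then_else_)
open import Data.Nat using (ℕ; zero; suc; _<ᵇ_) renaming (_*_ to _*ℕ_; _+_ to _+ℕ_)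
open import Data.Fin using (Fin; toℕ)
open import Data.List using (List; map; allFin)
open import Data.Nat.ListAction using (sum)
open import Data.Vec using (lookup)
open import Data.Fin.Subset using (Subset; ∣_∣)
open import Data.Integer using (+_)
open import Data.Rational using (ℚ; 0ℚ; _/_; _÷_; _<_)
open import Data.Rational.Properties using (pos⇒nonZero)
open import Relation.Binary.PropositionalEquality using (_≡_)

record Graph (n : ℕ) : Set where
  field
    adj    : Fin n → Fin n → Bool
    sym    : ∀ i j → adj i j ≡ adj j i
    irrefl : ∀ i → adj i i ≡ false
open Graph public

_∈ᵇ_ : ∀ {n} → Fin n → Subset n → Bool
i ∈ᵇ S = lookup S i

[_] : Bool → ℕ
[ true ]  = 1
[ false ] = 0

edgesIn : ∀ {n} → Graph n → Subset n → ℕ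
edgesIn {n} G S =
  sum (map (λ i → sum (map (λ j →
    [ (toℕ i <ᵇ toℕ j) ∧ (i ∈ᵇ S) ∧ (j ∈ᵇ S) ∧ adj G i j ]) (allFin n))) (allFin n))

-- e(S,T): number of pairs (i,j) with i ∈ S, j ∈ T, ij an edge
-- (equals the number of edges between S and T when S, T are disjoint)
edgesBetween : ∀ {n} → Graph n → Subset n → Subset n → ℕ
edgesBetween {n} G S T =
  sum (map (λ i → sum (map (λ j →
    [ (i ∈ᵇ S) ∧ (j ∈ᵇ T) ∧ adj G i j ]) (allFin n))) (allFin n))

ℕ→ℚ : ℕ → ℚ
ℕ→ℚ m = (+ m) / 1

-- average degree 2|E(F)|/|V(F)| of the induced subgraph G[S];
-- convention: the empty graph has average degree 0
avgDeg : ∀ {n} → Graph n → Subset n → ℚ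
avgDeg G S with ∣ S ∣
... | zero  = 0ℚ
... | suc k = (+ (2 *ℕ edgesIn G S)) / suc k

divPos : (p q : ℚ) → 0ℚ < q → ℚ
divPos p q h = _÷_ p q {{pos⇒nonZero q {{Data.Rational.positive h}}}}

module Submission where

-- Write D for the average degree of G, x, y, c for |X|, |Y|, |∁ X| and
-- t = 1/a.  Every edge of G lies inside X ∪ Y, inside ∁ X, or joins X to Z
-- (a vertex outside X lies in Y or in Z), so
--     D (x + c) = 2e(G) ≤ 2e(G[X ∪ Y]) + 2e(G[∁ X]) + 2e(X,Z).
-- If G ∖ X = G[∁ X] has average degree below D, then 2e(G[∁ X]) ≤ D c, and
-- together with 2e(X,Z) ≤ r t x / 2, y ≤ x t / 2 and D ≤ r this gives
--     (D - r t)(x + y) ≤ 2e(G[X ∪ Y]),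
-- which, divided by |X ∪ Y| = x + y > 0, is the second alternative.

open import Defs hiding (sym)
open import Data.Bool using (true; false; _∧_; _∨_; not)
open import Data.Bool.Properties using (∧-zeroʳ)
open import Data.Nat as ℕ using (ℕ; zero; suc; z≤n; s≤s; _<ᵇ_)
import Data.Nat.Properties as ℕP
open import Data.Nat.ListAction using () renaming (sum to listSum)
open import Data.Integer as ℤ using (+_)
import Data.Integer.Properties as ℤP
open import Data.Fin using (Fin; toℕ) renaming (zero to fzero; suc to fsuc)
open import Data.Fin.Subset using (Subset; _∩_; _∪_; ⊥; ⊤; ∁; ∣_∣; Nonempty; _∈_; _⊆_; ⁅_⁆)
open import Data.Fin.Subset.Properties
  using (∣⊤∣≡n; ∣∁p∣≡n∸∣p∣; ∣p∣≤n; p⊆q⇒∣p∣≤∣q∣; ∣⁅x⁆∣≡1; x∈⁅y⁆⇒x≡y; ∣p∣≤∣p∪q∣)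
open import Data.List using (map; allFin; tabulate)
open import Data.List.Properties using (map-tabulate)
open import Data.Vec using (lookup; _∷_; [])
open import Data.Vec.Properties using (lookup-zipWith; lookup-map; lookup-replicate; ∷-injectiveʳ)
open import Data.Rational using (ℚ; 0ℚ; _<_; _≤_; _*_; _+_; _-_; -_; _/_; 1/_; toℚᵘ; *<*; NonZero; positive; nonNegative)
open import Data.Rational.Properties
  using ( toℚᵘ-injective; toℚᵘ-fromℚᵘ; toℚᵘ-homo-+; toℚᵘ-homo-*; toℚᵘ-cancel-≤
        ; <⇒≤; ≰⇒>; _≤?_; <-≤-trans; +-mono-≤; +-monoˡ-≤; +-inverseʳ; +-identityˡ
        ; *-zeroʳ; *-monoˡ-≤-nonNeg; *-monoʳ-≤-nonNeg; *-cancelʳ-≤-pos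
        ; pos⇒nonZero; 1/pos⇒pos; positive⁻¹; module ≤-Reasoning)
open import Data.Rational.Unnormalised as ℚᵘ using (mkℚᵘ; *≡*; *≤*) renaming (_≃_ to _≃ᵘ_)
import Data.Rational.Unnormalised.Properties as ℚᵘP
open import Data.Rational.Solver using (module +-*-Solver)
open import Data.Sum using (_⊎_; inj₁; inj₂)
open import Data.Product using (_,_)
open import Algebra.Properties.CommutativeMonoid.Sum ℕP.+-0-commutativeMonoid
  using (∑-distrib-+; ∑-comm; sum-cong-≗; sum-replicate-zero) renaming (sum to ∑)
open import Relation.Nullary using (yes; no)
open import Relation.Binary.PropositionalEquality
  using (_≡_; refl; sym; trans; cong; cong₂; subst; subst₂; module ≡-Reasoning)

-- ℕ→ℚ m is the normal form of the unnormalised fraction m/1; the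
-- algebraic properties below are transported along this fact.
ℕ→ℚ-unnormalised : ∀ m → toℚᵘ (ℕ→ℚ m) ≃ᵘ mkℚᵘ (+ m) 0
ℕ→ℚ-unnormalised m = toℚᵘ-fromℚᵘ (mkℚᵘ (+ m) 0)

ℕ→ℚ-+ : ∀ m n → ℕ→ℚ (m ℕ.+ n) ≡ ℕ→ℚ m + ℕ→ℚ n
ℕ→ℚ-+ m n = toℚᵘ-injective (begin
    toℚᵘ (ℕ→ℚ (m ℕ.+ n))            ≈⟨ ℕ→ℚ-unnormalised (m ℕ.+ n) ⟩
    mkℚᵘ (+ (m ℕ.+ n)) 0             ≈⟨ *≡* numerators ⟩
    mkℚᵘ (+ m) 0 ℚᵘ.+ mkℚᵘ (+ n) 0   ≈⟨ ℚᵘP.+-cong (ℕ→ℚ-unnormalised m) (ℕ→ℚ-unnormalised n) ⟨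
    toℚᵘ (ℕ→ℚ m) ℚᵘ.+ toℚᵘ (ℕ→ℚ n)  ≈⟨ toℚᵘ-homo-+ (ℕ→ℚ m) (ℕ→ℚ n) ⟨
    toℚᵘ (ℕ→ℚ m + ℕ→ℚ n)             ∎)
  where
  open ℚᵘP.≃-Reasoning
  numerators : + (m ℕ.+ n) ℤ.* (+ 1 ℤ.* + 1) ≡ (+ m ℤ.* + 1 ℤ.+ + n ℤ.* + 1) ℤ.* + 1
  numerators rewrite ℤP.*-identityʳ (+ m) | ℤP.*-identityʳ (+ n)
                   | ℤP.*-identityʳ (+ m ℤ.+ + n) = ℤP.pos-+ m n

ℕ→ℚ-* : ∀ m n → ℕ→ℚ (m ℕ.* n) ≡ ℕ→ℚ m * ℕ→ℚ n
ℕ→ℚ-* m n = toℚᵘ-injective (begin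
    toℚᵘ (ℕ→ℚ (m ℕ.* n))            ≈⟨ ℕ→ℚ-unnormalised (m ℕ.* n) ⟩
    mkℚᵘ (+ (m ℕ.* n)) 0             ≈⟨ *≡* numerators ⟩
    mkℚᵘ (+ m) 0 ℚᵘ.* mkℚᵘ (+ n) 0   ≈⟨ ℚᵘP.*-cong (ℕ→ℚ-unnormalised m) (ℕ→ℚ-unnormalised n) ⟨
    toℚᵘ (ℕ→ℚ m) ℚᵘ.* toℚᵘ (ℕ→ℚ n)  ≈⟨ toℚᵘ-homo-* (ℕ→ℚ m) (ℕ→ℚ n) ⟨
    toℚᵘ (ℕ→ℚ m * ℕ→ℚ n)             ∎)
  where
  open ℚᵘP.≃-Reasoning
  numerators : + (m ℕ.* n) ℤ.* (+ 1 ℤ.* + 1) ≡ (+ m ℤ.* + n) ℤ.* + 1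
  numerators rewrite ℤP.*-identityʳ (+ (m ℕ.* n)) | ℤP.*-identityʳ (+ m ℤ.* + n) = ℤP.pos-* m n

ℕ→ℚ-mono : ∀ {m n} → m ℕ.≤ n → ℕ→ℚ m ≤ ℕ→ℚ n
ℕ→ℚ-mono {m} {n} m≤n = toℚᵘ-cancel-≤
    (ℚᵘP.≤-respʳ-≃ (ℚᵘP.≃-sym (ℕ→ℚ-unnormalised n))
      (ℚᵘP.≤-respˡ-≃ (ℚᵘP.≃-sym (ℕ→ℚ-unnormalised m)) (*≤* numerators)))
  where
  numerators : + m ℤ.* + 1 ℤ.≤ + n ℤ.* + 1
  numerators rewrite ℤP.*-identityʳ (+ m) | ℤP.*-identityʳ (+ n) = ℤ.+≤+ m≤n

ℕ→ℚ-nonNeg : ∀ m → 0ℚ ≤ ℕ→ℚ m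
ℕ→ℚ-nonNeg m = ℕ→ℚ-mono {0} {m} z≤n

ℕ→ℚ-pos : ∀ {m} → 1 ℕ.≤ m → 0ℚ < ℕ→ℚ m
ℕ→ℚ-pos 1≤m = <-≤-trans (*<* (ℤ.+<+ (s≤s z≤n))) (ℕ→ℚ-mono 1≤m)

fraction-cancel : ∀ m k → ((+ m) / suc k) * ℕ→ℚ (suc k) ≡ ℕ→ℚ m
fraction-cancel m k = toℚᵘ-injective (begin
    toℚᵘ (((+ m) / suc k) * ℕ→ℚ (suc k))           ≈⟨ toℚᵘ-homo-* ((+ m) / suc k) (ℕ→ℚ (suc k)) ⟩
    toℚᵘ ((+ m) / suc k) ℚᵘ.* toℚᵘ (ℕ→ℚ (suc k))  ≈⟨ ℚᵘP.*-cong (toℚᵘ-fromℚᵘ (mkℚᵘ (+ m) k))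
                                                                (ℕ→ℚ-unnormalised (suc k)) ⟩
    mkℚᵘ (+ m) k ℚᵘ.* mkℚᵘ (+ suc k) 0             ≈⟨ *≡* (ℤP.*-assoc (+ m) (+ suc k) (+ 1)) ⟩
    mkℚᵘ (+ m) 0                                    ≈⟨ ℕ→ℚ-unnormalised m ⟨
    toℚᵘ (ℕ→ℚ m)                                    ∎)
  where open ℚᵘP.≃-Reasoning

-- Constants of the statement: the factor 2 in 2e and the 1/4 in e(X,Z) ≤ rx/4a.
two ¼ : ℚ
two = ℕ→ℚ 2
¼   = + 1 / 4

nonNeg-* : ∀ {p q} → 0ℚ ≤ p → 0ℚ ≤ q → 0ℚ ≤ p * q
nonNeg-* {p} {q} 0≤p 0≤q = subst (_≤ p * q) (*-zeroʳ p) (*-monoˡ-≤-nonNeg p {{nonNegative 0≤p}} 0≤q)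

nonNeg-difference : ∀ {p q} → p ≤ q → 0ℚ ≤ q - p
nonNeg-difference {p} {q} p≤q = subst (_≤ q - p) (+-inverseʳ p) (+-monoˡ-≤ (- p) p≤q)

difference-nonNeg : ∀ {p q} → 0ℚ ≤ q - p → p ≤ q
difference-nonNeg {p} {q} 0≤q-p = subst₂ _≤_ (+-identityˡ p) (q-p+p≡q q p) (+-monoˡ-≤ p 0≤q-p)
  where
  open +-*-Solver
  q-p+p≡q : ∀ q p → q - p + p ≡ q
  q-p+p≡q = solve 2 (λ q p → q :- p :+ p := q) refl

-- Read D as the average degree, x = 2h,
-- y, c as |X|, |Y|, |∁ X|, P and Q as twice the numbers of edges inside
-- X ∪ Y and inside ∁ X, B as e(X,Z) and t as 1/a.  The difference
-- P - (D - rt)(x + y) is a non-negative combination of the hypotheses.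
dense-estimate : ∀ {D r t x h y c P Q B : ℚ} →
  0ℚ ≤ r → 0ℚ ≤ t → 0ℚ ≤ y → D ≤ r → h * two ≡ x →
  D * (x + c) ≤ P + Q + two * B →
  Q ≤ D * c →
  B ≤ r * ¼ * x * t →
  y ≤ h * t →
  (D - r * t) * (x + y) ≤ P
dense-estimate {D} {r} {t} {_} {h} {y} {c} {P} {Q} {B} 0≤r 0≤t 0≤y D≤r refl count rest cross small =
  difference-nonNeg (subst (0ℚ ≤_) (certificate D r t h y c P Q B) combination)
  where
  open +-*-Solver
  combination : 0ℚ ≤ ((P + Q + two * B) - D * (h * two + c)) + (D * c - Q)
                    + two * (r * ¼ * (h * two) * t - B) + (r - D) * y
                    + (r * t) * y + r * (h * t - y)
  combination =
    +-mono-≤ (+-mono-≤ (+-mono-≤ (+-mono-≤ (+-mono-≤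
      (nonNeg-difference count) (nonNeg-difference rest))
      (nonNeg-* (ℕ→ℚ-nonNeg 2) (nonNeg-difference cross)))
      (nonNeg-* (nonNeg-difference D≤r) 0≤y))
      (nonNeg-* (nonNeg-* 0≤r 0≤t) 0≤y))
      (nonNeg-* 0≤r (nonNeg-difference small))
  certificate : ∀ D r t h y c P Q B →
    ((P + Q + two * B) - D * (h * two + c)) + (D * c - Q)
      + two * (r * ¼ * (h * two) * t - B) + (r - D) * y
      + (r * t) * y + r * (h * t - y)
    ≡ P - (D - r * t) * (h * two + y)
  certificate = solve 9 (λ D r t h y c P Q B →
    ((P :+ Q :+ con two :* B) :- D :* (h :* con two :+ c)) :+ (D :* c :- Q)
      :+ con two :* (r :* con ¼ :* (h :* con two) :* t :- B) :+ (r :- D) :* y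
      :+ (r :* t) :* y :+ r :* (h :* t :- y)
    := P :- (D :- r :* t) :* (h :* con two :+ y)) refl

-- The list sums used in Defs agree with the finite sums ∑ over Fin n,
-- for which the library provides distributivity and interchange.
listSum-tabulate : ∀ {n} (f : Fin n → ℕ) → listSum (tabulate f) ≡ ∑ f
listSum-tabulate {zero}  f = refl
listSum-tabulate {suc n} f = cong (f fzero ℕ.+_) (listSum-tabulate (λ i → f (fsuc i)))

listSum-allFin : ∀ {n} (f : Fin n → ℕ) → listSum (map f (allFin n)) ≡ ∑ f
listSum-allFin f = trans (cong listSum (map-tabulate (λ i → i) f)) (listSum-tabulate f)

ΣΣ : ∀ {n} → (Fin n → Fin n → ℕ) → ℕ
ΣΣ f = ∑ (λ i → ∑ (f i))

doubleListSum : ∀ {n} (f : Fin n → Fin n → ℕ) →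
  listSum (map (λ i → listSum (map (f i) (allFin n))) (allFin n)) ≡ ΣΣ f
doubleListSum {n} f = trans (listSum-allFin (λ i → listSum (map (f i) (allFin n))))
                            (sum-cong-≗ (λ i → listSum-allFin (f i)))

∑-mono : ∀ {n} {f g : Fin n → ℕ} → (∀ i → f i ℕ.≤ g i) → ∑ f ℕ.≤ ∑ g
∑-mono {zero}  f≤g = z≤n
∑-mono {suc n} f≤g = ℕP.+-mono-≤ (f≤g fzero) (∑-mono (λ i → f≤g (fsuc i)))

ΣΣ-mono : ∀ {n} {f g : Fin n → Fin n → ℕ} → (∀ i j → f i j ℕ.≤ g i j) → ΣΣ f ℕ.≤ ΣΣ g
ΣΣ-mono f≤g = ∑-mono (λ i → ∑-mono (f≤g i))

ΣΣ-+ : ∀ {n} (f g : Fin n → Fin n → ℕ) → ΣΣ (λ i j → f i j ℕ.+ g i j) ≡ ΣΣ f ℕ.+ ΣΣ g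
ΣΣ-+ f g = trans (sum-cong-≗ (λ i → ∑-distrib-+ (f i) (g i)))
                 (∑-distrib-+ (λ i → ∑ (f i)) (λ i → ∑ (g i)))

ΣΣ-zero : ∀ {n} (f : Fin n → Fin n → ℕ) → (∀ i j → f i j ≡ 0) → ΣΣ f ≡ 0
ΣΣ-zero {n} f f≡0 = trans (sum-cong-≗ (λ i → trans (sum-cong-≗ (f≡0 i)) (sum-replicate-zero n)))
                          (sum-replicate-zero n)

card-complement : ∀ {n} (X : Subset n) → ∣ ⊤ {n} ∣ ≡ ∣ X ∣ ℕ.+ ∣ ∁ X ∣
card-complement {n} X = trans (∣⊤∣≡n n)
  (sym (trans (cong (∣ X ∣ ℕ.+_) (∣∁p∣≡n∸∣p∣ X)) (ℕP.m+[n∸m]≡n (∣p∣≤n X))))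

card-disjoint-∪ : ∀ {n} (p q : Subset n) → p ∩ q ≡ ⊥ → ∣ p ∪ q ∣ ≡ ∣ p ∣ ℕ.+ ∣ q ∣
card-disjoint-∪ []          []          _ = refl
card-disjoint-∪ (true ∷ p)  (true ∷ q)  ()
card-disjoint-∪ (true ∷ p)  (false ∷ q) d = cong suc (card-disjoint-∪ p q (∷-injectiveʳ d))
card-disjoint-∪ (false ∷ p) (true ∷ q)  d =
  trans (cong suc (card-disjoint-∪ p q (∷-injectiveʳ d))) (sym (ℕP.+-suc ∣ p ∣ ∣ q ∣))
card-disjoint-∪ (false ∷ p) (false ∷ q) d = card-disjoint-∪ p q (∷-injectiveʳ d)

card-nonempty : ∀ {n} (p : Subset n) → Nonempty p → 1 ℕ.≤ ∣ p ∣
card-nonempty p (i , i∈p) = subst (ℕ._≤ ∣ p ∣) (∣⁅x⁆∣≡1 i) (p⊆q⇒∣p∣≤∣q∣ ⁅i⁆⊆p)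
  where
  ⁅i⁆⊆p : ⁅ i ⁆ ⊆ p
  ⁅i⁆⊆p j∈⁅i⁆ = subst (_∈ p) (sym (x∈⁅y⁆⇒x≡y i j∈⁅i⁆)) i∈p

card-zero : ∀ {n} (p : Subset n) → ∣ p ∣ ≡ 0 → ∀ i → lookup p i ≡ false
card-zero (false ∷ p) _  fzero    = refl
card-zero (false ∷ p) p₀ (fsuc i) = card-zero p p₀ i
card-zero (true ∷ p)  ()

lookup-∪ : ∀ {n} (p q : Subset n) i → lookup (p ∪ q) i ≡ lookup p i ∨ lookup q i
lookup-∪ p q i = lookup-zipWith _∨_ i p q

covered : ∀ {n} {X Y Z : Subset n} → X ∪ Y ∪ Z ≡ ⊤ →
  ∀ i → lookup X i ∨ (lookup Y i ∨ lookup Z i) ≡ true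
covered {n} {X} {Y} {Z} cover i = begin
    lookup X i ∨ (lookup Y i ∨ lookup Z i)  ≡⟨ cong (lookup X i ∨_) (lookup-∪ Y Z i) ⟨
    lookup X i ∨ lookup (Y ∪ Z) i           ≡⟨ lookup-∪ X (Y ∪ Z) i ⟨
    lookup (X ∪ Y ∪ Z) i                    ≡⟨ cong (λ V → lookup V i) cover ⟩
    lookup (⊤ {n}) i                        ≡⟨ lookup-replicate i true ⟩
    true                                    ∎
  where open ≡-Reasoning

order-exclusive : ∀ m n → [ m <ᵇ n ] ℕ.+ [ n <ᵇ m ] ℕ.≤ 1
order-exclusive zero    zero    = z≤n
order-exclusive zero    (suc n) = s≤s z≤n
order-exclusive (suc m) zero    = s≤s z≤n
order-exclusive (suc m) (suc n) = order-exclusive m n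

-- Hence the two orientations of a pair contribute at most once in total.
at-most-one : ∀ l₁ l₂ b → [ l₁ ] ℕ.+ [ l₂ ] ℕ.≤ 1 → [ l₁ ∧ b ] ℕ.+ [ l₂ ∧ b ] ℕ.≤ [ b ]
at-most-one true  true  b (s≤s ())
at-most-one true  false b _ = ℕP.≤-reflexive (ℕP.+-identityʳ [ b ])
at-most-one false true  b _ = ℕP.≤-refl
at-most-one false false b _ = z≤n

-- A pair i < j (flag l) that is an edge (flag a), with each end in X, Y or Z,
-- lies inside X ∪ Y, lies inside ∁ X, or joins X to Z (with the X-end
-- smaller or larger).
pair-cover : ∀ l a xi yi zi xj yj zj → xi ∨ (yi ∨ zi) ≡ true → xj ∨ (yj ∨ zj) ≡ true →
  [ l ∧ true ∧ true ∧ a ] ℕ.≤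
    [ l ∧ (xi ∨ yi) ∧ (xj ∨ yj) ∧ a ] ℕ.+ [ l ∧ not xi ∧ not xj ∧ a ]
      ℕ.+ ([ l ∧ xi ∧ zj ∧ a ] ℕ.+ [ l ∧ xj ∧ zi ∧ a ])
pair-cover false _     _     _     _ _     _     _ _    _    = z≤n
pair-cover true  false _     _     _ _     _     _ _    _    = z≤n
pair-cover true  true  true  _     _ true  _     _ _    _    = s≤s z≤n
pair-cover true  true  true  _     _ false true  _ _    _    = s≤s z≤n
pair-cover true  true  true  _     _ false false _ _    refl = s≤s z≤n
pair-cover true  true  false true  _ true  _     _ _    _    = s≤s z≤n
pair-cover true  true  false false _ true  _     _ refl _    = s≤s z≤n
pair-cover true  true  false false _ false _     _ _    _    = s≤s z≤n
pair-cover true  true  false true  _ false false _ _    _    = s≤s z≤n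
pair-cover true  true  false true  _ false true  _ _    _    = s≤s z≤n

edgeInside : ∀ {n} → Graph n → Subset n → Fin n → Fin n → ℕ
edgeInside G S i j = [ (toℕ i <ᵇ toℕ j) ∧ (i ∈ᵇ S) ∧ (j ∈ᵇ S) ∧ adj G i j ]

edgeAcross : ∀ {n} → Graph n → Subset n → Subset n → Fin n → Fin n → ℕ
edgeAcross G S T i j = [ (i ∈ᵇ S) ∧ (j ∈ᵇ T) ∧ adj G i j ]

lowerEnd upperEnd : ∀ {n} → Graph n → Subset n → Subset n → Fin n → Fin n → ℕ
lowerEnd G S T i j = [ (toℕ i <ᵇ toℕ j) ∧ (i ∈ᵇ S) ∧ (j ∈ᵇ T) ∧ adj G i j ]
upperEnd G S T i j = [ (toℕ i <ᵇ toℕ j) ∧ (j ∈ᵇ S) ∧ (i ∈ᵇ T) ∧ adj G i j ]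

edgesIn-ΣΣ : ∀ {n} (G : Graph n) S → edgesIn G S ≡ ΣΣ (edgeInside G S)
edgesIn-ΣΣ G S = doubleListSum (edgeInside G S)

edgesBetween-ΣΣ : ∀ {n} (G : Graph n) S T → edgesBetween G S T ≡ ΣΣ (edgeAcross G S T)
edgesBetween-ΣΣ G S T = doubleListSum (edgeAcross G S T)

oriented-edges : ∀ {n} (G : Graph n) S T →
  ΣΣ (lowerEnd G S T) ℕ.+ ΣΣ (upperEnd G S T) ℕ.≤ edgesBetween G S T
oriented-edges {n} G S T = begin
    ΣΣ low ℕ.+ ΣΣ up                         ≡⟨ cong (ΣΣ low ℕ.+_) (∑-comm up) ⟩
    ΣΣ low ℕ.+ ΣΣ (λ i j → up j i)           ≡⟨ ΣΣ-+ low (λ i j → up j i) ⟨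
    ΣΣ (λ i j → low i j ℕ.+ up j i)          ≤⟨ ΣΣ-mono once ⟩
    ΣΣ (edgeAcross G S T)                    ≡⟨ edgesBetween-ΣΣ G S T ⟨
    edgesBetween G S T                       ∎
  where
  open ℕP.≤-Reasoning
  low up : Fin n → Fin n → ℕ
  low = lowerEnd G S T
  up  = upperEnd G S T
  once : ∀ i j → low i j ℕ.+ up j i ℕ.≤ edgeAcross G S T i j
  once i j rewrite Graph.sym G j i =
    at-most-one (toℕ i <ᵇ toℕ j) (toℕ j <ᵇ toℕ i) _ (order-exclusive (toℕ i) (toℕ j))

edge-split : ∀ {n} (G : Graph n) (X Y Z : Subset n) → X ∪ Y ∪ Z ≡ ⊤ →
  edgesIn G ⊤ ℕ.≤ edgesIn G (X ∪ Y) ℕ.+ edgesIn G (∁ X) ℕ.+ edgesBetween G X Z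
edge-split {n} G X Y Z cover = begin
    edgesIn G ⊤                                          ≡⟨ edgesIn-ΣΣ G ⊤ ⟩
    ΣΣ (edgeInside G ⊤)                                  ≤⟨ ΣΣ-mono pair-split ⟩
    ΣΣ (λ i j → inXY i j ℕ.+ in∁X i j ℕ.+ (low i j ℕ.+ up i j))
      ≡⟨ trans (ΣΣ-+ (λ i j → inXY i j ℕ.+ in∁X i j) (λ i j → low i j ℕ.+ up i j))
               (cong₂ ℕ._+_ (ΣΣ-+ inXY in∁X) (ΣΣ-+ low up)) ⟩
    ΣΣ inXY ℕ.+ ΣΣ in∁X ℕ.+ (ΣΣ low ℕ.+ ΣΣ up)
      ≤⟨ ℕP.+-monoʳ-≤ (ΣΣ inXY ℕ.+ ΣΣ in∁X) (oriented-edges G X Z) ⟩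
    ΣΣ inXY ℕ.+ ΣΣ in∁X ℕ.+ edgesBetween G X Z
      ≡⟨ cong (ℕ._+ edgesBetween G X Z) (cong₂ ℕ._+_ (edgesIn-ΣΣ G (X ∪ Y)) (edgesIn-ΣΣ G (∁ X))) ⟨
    edgesIn G (X ∪ Y) ℕ.+ edgesIn G (∁ X) ℕ.+ edgesBetween G X Z ∎
  where
  open ℕP.≤-Reasoning
  inXY in∁X low up : Fin n → Fin n → ℕ
  inXY = edgeInside G (X ∪ Y)
  in∁X = edgeInside G (∁ X)
  low  = lowerEnd G X Z
  up   = upperEnd G X Z
  pair-split : ∀ i j → edgeInside G ⊤ i j ℕ.≤ inXY i j ℕ.+ in∁X i j ℕ.+ (low i j ℕ.+ up i j)
  pair-split i j
    rewrite lookup-replicate i true | lookup-replicate j true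
          | lookup-∪ X Y i | lookup-∪ X Y j | lookup-map i not X | lookup-map j not X =
    pair-cover (toℕ i <ᵇ toℕ j) (adj G i j)
               (lookup X i) (lookup Y i) (lookup Z i) (lookup X j) (lookup Y j) (lookup Z j)
               (covered cover i) (covered cover j)

-- Average degree times order is twice the number of edges (also for the
-- empty vertex set, which spans no edge).
degree-sum : ∀ {n} (G : Graph n) (S : Subset n) →
  ℕ→ℚ (2 ℕ.* edgesIn G S) ≡ avgDeg G S * ℕ→ℚ ∣ S ∣
degree-sum G S with ∣ S ∣ in size
... | zero  = cong (λ e → ℕ→ℚ (2 ℕ.* e)) no-edges
  where
  no-edges : edgesIn G S ≡ 0
  no-edges = trans (edgesIn-ΣΣ G S) (ΣΣ-zero (edgeInside G S) no-edge)
    where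
    no-edge : ∀ i j → edgeInside G S i j ≡ 0
    no-edge i j rewrite card-zero S size i = cong [_] (∧-zeroʳ (toℕ i <ᵇ toℕ j))
... | suc k = sym (fraction-cancel (2 ℕ.* edgesIn G S) k)

sparse-bound : ∀ {n} (G : Graph n) (S : Subset n) {D : ℚ} → avgDeg G S ≤ D →
  ℕ→ℚ (2 ℕ.* edgesIn G S) ≤ D * ℕ→ℚ ∣ S ∣
sparse-bound G S {D} avg≤D = begin
    ℕ→ℚ (2 ℕ.* edgesIn G S)  ≡⟨ degree-sum G S ⟩
    avgDeg G S * ℕ→ℚ ∣ S ∣   ≤⟨ *-monoʳ-≤-nonNeg (ℕ→ℚ ∣ S ∣) {{nonNegative (ℕ→ℚ-nonNeg ∣ S ∣)}} avg≤D ⟩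
    D * ℕ→ℚ ∣ S ∣            ∎
  where open ≤-Reasoning

degree-split : ∀ {n} (G : Graph n) (X Y Z : Subset n) → X ∪ Y ∪ Z ≡ ⊤ →
  avgDeg G ⊤ * (ℕ→ℚ ∣ X ∣ + (ℕ→ℚ ∣ ∁ X ∣))
    ≤ ℕ→ℚ (2 ℕ.* edgesIn G (X ∪ Y)) + ℕ→ℚ (2 ℕ.* edgesIn G (∁ X)) + two * ℕ→ℚ (edgesBetween G X Z)
degree-split {n} G X Y Z cover = begin
    avgDeg G ⊤ * (ℕ→ℚ ∣ X ∣ + (ℕ→ℚ ∣ ∁ X ∣))
      ≡⟨ cong (avgDeg G ⊤ *_) (trans (cong ℕ→ℚ (card-complement X)) (ℕ→ℚ-+ ∣ X ∣ ∣ ∁ X ∣)) ⟨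
    avgDeg G ⊤ * ℕ→ℚ ∣ ⊤ {n} ∣                  ≡⟨ degree-sum G ⊤ ⟨
    ℕ→ℚ (2 ℕ.* edgesIn G ⊤)                    ≤⟨ ℕ→ℚ-mono (ℕP.*-monoʳ-≤ 2 (edge-split G X Y Z cover)) ⟩
    ℕ→ℚ (2 ℕ.* (exy ℕ.+ e∁x ℕ.+ exz))           ≡⟨ cong ℕ→ℚ (distribute exy e∁x exz) ⟩
    ℕ→ℚ (2 ℕ.* exy ℕ.+ 2 ℕ.* e∁x ℕ.+ 2 ℕ.* exz) ≡⟨ ℕ→ℚ-+ (2 ℕ.* exy ℕ.+ 2 ℕ.* e∁x) (2 ℕ.* exz) ⟩
    ℕ→ℚ (2 ℕ.* exy ℕ.+ 2 ℕ.* e∁x) + ℕ→ℚ (2 ℕ.* exz)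
      ≡⟨ cong₂ _+_ (ℕ→ℚ-+ (2 ℕ.* exy) (2 ℕ.* e∁x)) (ℕ→ℚ-* 2 exz) ⟩
    ℕ→ℚ (2 ℕ.* exy) + ℕ→ℚ (2 ℕ.* e∁x) + two * ℕ→ℚ exz ∎
  where
  open ≤-Reasoning
  exy e∁x exz : ℕ
  exy = edgesIn G (X ∪ Y)
  e∁x = edgesIn G (∁ X)
  exz = edgesBetween G X Z
  distribute : ∀ a b c → 2 ℕ.* (a ℕ.+ b ℕ.+ c) ≡ 2 ℕ.* a ℕ.+ 2 ℕ.* b ℕ.+ 2 ℕ.* c
  distribute a b c = trans (ℕP.*-distribˡ-+ 2 (a ℕ.+ b) c) (cong (ℕ._+ 2 ℕ.* c) (ℕP.*-distribˡ-+ 2 a b))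

-- The second alternative, under the assumption that G ∖ X is sparser than G
-- (t plays the role of 1/a).
dense-side : ∀ {n} (G : Graph n) (X Y Z : Subset n) {r t : ℚ} → 0ℚ ≤ r → 0ℚ ≤ t →
  X ∩ Y ≡ ⊥ → X ∪ Y ∪ Z ≡ ⊤ → Nonempty X →
  avgDeg G (∁ X) < avgDeg G ⊤ → avgDeg G ⊤ ≤ r →
  ℕ→ℚ ∣ Y ∣ ≤ (+ ∣ X ∣) / 2 * t →
  ℕ→ℚ (edgesBetween G X Z) ≤ r * ¼ * ℕ→ℚ ∣ X ∣ * t →
  avgDeg G ⊤ - r * t ≤ avgDeg G (X ∪ Y)
dense-side G X Y Z {r} {t} 0≤r 0≤t X∩Y≡⊥ cover X-nonempty rest-sparse D≤r small-Y few-XZ =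
  *-cancelʳ-≤-pos (ℕ→ℚ ∣ X ∪ Y ∣) {{positive order-pos}} (begin
    (avgDeg G ⊤ - r * t) * ℕ→ℚ ∣ X ∪ Y ∣               ≡⟨ cong ((avgDeg G ⊤ - r * t) *_) order-XY ⟩
    (avgDeg G ⊤ - r * t) * (ℕ→ℚ ∣ X ∣ + (ℕ→ℚ ∣ Y ∣))
      ≤⟨ dense-estimate {h = (+ ∣ X ∣) / 2} 0≤r 0≤t (ℕ→ℚ-nonNeg ∣ Y ∣) D≤r (fraction-cancel ∣ X ∣ 1)
           (degree-split G X Y Z cover) (sparse-bound G (∁ X) (<⇒≤ rest-sparse)) few-XZ small-Y ⟩
    ℕ→ℚ (2 ℕ.* edgesIn G (X ∪ Y))                       ≡⟨ degree-sum G (X ∪ Y) ⟩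
    avgDeg G (X ∪ Y) * ℕ→ℚ ∣ X ∪ Y ∣                    ∎)
  where
  open ≤-Reasoning
  order-XY : ℕ→ℚ ∣ X ∪ Y ∣ ≡ ℕ→ℚ ∣ X ∣ + (ℕ→ℚ ∣ Y ∣)
  order-XY = trans (cong ℕ→ℚ (card-disjoint-∪ X Y X∩Y≡⊥)) (ℕ→ℚ-+ ∣ X ∣ ∣ Y ∣)
  order-pos : 0ℚ < ℕ→ℚ ∣ X ∪ Y ∣
  order-pos = ℕ→ℚ-pos (ℕP.≤-trans (card-nonempty X X-nonempty) (∣p∣≤∣p∪q∣ X Y))

lemma7p1 : (a r : ℚ) (ha : 0ℚ < a) → 0ℚ < r →
  (n : ℕ) (G : Graph n) (X Y Z : Subset n) →
  X ∩ Y ≡ ⊥ → X ∩ Z ≡ ⊥ → Y ∩ Z ≡ ⊥ → X ∪ Y ∪ Z ≡ ⊤ →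
  Nonempty X →
  avgDeg G ⊤ ≤ r →
  ℕ→ℚ ∣ Y ∣ ≤ divPos ((+ ∣ X ∣) / 2) a ha →
  ℕ→ℚ (edgesBetween G X Z) ≤ divPos (r * (+ 1 / 4) * ℕ→ℚ ∣ X ∣) a ha →
  (avgDeg G ⊤ ≤ avgDeg G (∁ X))
    ⊎ (avgDeg G ⊤ - divPos r a ha ≤ avgDeg G (X ∪ Y))
lemma7p1 a r ha hr n G X Y Z X∩Y≡⊥ _ _ cover X-nonempty D≤r small-Y few-XZ
  with avgDeg G ⊤ ≤? avgDeg G (∁ X)
... | yes rest-dense  = inj₁ rest-dense
... | no  rest-sparse = inj₂ (dense-side G X Y Z (<⇒≤ hr) 0≤1/a X∩Y≡⊥ cover X-nonempty
                                          (≰⇒> rest-sparse) D≤r small-Y few-XZ)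
  where
  instance
    a≢0 : NonZero a
    a≢0 = pos⇒nonZero a {{positive ha}}
  0≤1/a : 0ℚ ≤ 1/ a
  0≤1/a = <⇒≤ (positive⁻¹ (1/ a) {{1/pos⇒pos a {{positive ha}}}})
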